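{- Let $(P,\le,{}',0,1)$ be a Boolean poset and let $\Theta,\Phi$ be congruences on it. Assume that $LU(x,y')\cap[1]\Psi\ne\emptyset$ for all $\Psi\in\{\Theta,\Phi\}$ and all $(x,y)\in\Psi$ with $x\le y$. Moreover, suppose $[1]\Theta=[1]\Phi$. Then $\Theta=\Phi$.
   Context: For a poset $(P,\le)$ and $A\subseteq P$ let $L(A)=\{x\mid x\le y\ \forall y\in A\}$, $U(A)=\{x\mid y\le x\ \forall y\in A\}$; write $L(x,y)=L(\{x,y\})$, $U(x,y)$, $LU(x,y)=L(U(x,y))$, etc.; $\operatorname{Max}A$, $\operatorname{Min}A$ are the sets of maximal, minimal elements. A poset is distributive if $L(U(x,y),z)=LU(L(x,z),L(y,z))$ for all $x,y,z$. A complementation on a bounded poset $(P,\le,0,1)$ is a unary operation $'$ with $U(x,x')=\{1\}$ and $L(x,x')=\{0\}$; a Boolean poset is a distributive bounded poset with a complementation. A binary relation $R$ is compatible with a map $Q\colon P^2\to2^P$ if whenever $(a_1,b_1),(a_2,b_2)\in R$ there exist $a\in Q(a_1,a_2)$, $b\in Q(b_1,b_2)$ with $(a,b)\in R$. A congruence on a Boolean poset is an equivalence relation compatible with $(x,y)\mapsto\operatorname{Max}L(x,y)$, $(x,y)\mapsto\operatorname{Min}U(x,y)$ and $'$ (i.e. $(a,b)\in\Theta\Rightarrow(a',b')\in\Theta$); $[1]\Theta$ is the class of $1$. -}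

module Defs where

open import Data.Product using (Σ; _×_; _,_; ∃)
open import Function.Bundles using (_⇔_)
open import Relation.Binary.PropositionalEquality using (_≡_)
open import Relation.Binary.Structures using (IsPartialOrder; IsEquivalence)

Subset : Set → Set₁
Subset P = P → Set

_≐_ : {P : Set} → Subset P → Subset P → Set
A ≐ B = ∀ w → (A w ⇔ B w)

record Poset₀ : Set₁ where
  field
    Carrier : Set
    _≤_ : Carrier → Carrier → Set
    isPartialOrder : IsPartialOrder _≡_ _≤_

module PosetOps (𝑷 : Poset₀) where
  open Poset₀ 𝑷
  open import Data.Sum using (_⊎_)

  L : Subset Carrier → Subset Carrier
  L A x = ∀ y → A y → x ≤ y

  U : Subset Carrier → Subset Carrier
  U A x = ∀ y → A y → y ≤ x

  ⟦_,_⟧ : Carrier → Carrier → Subset Carrier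
  ⟦ x , y ⟧ w = (w ≡ x) ⊎ (w ≡ y)

  _∪[_] : Subset Carrier → Carrier → Subset Carrier
  (A ∪[ z ]) w = A w ⊎ (w ≡ z)

  _∪_ : Subset Carrier → Subset Carrier → Subset Carrier
  (A ∪ B) w = A w ⊎ B w

  L₂ U₂ LU₂ : Carrier → Carrier → Subset Carrier
  L₂ x y = L ⟦ x , y ⟧
  U₂ x y = U ⟦ x , y ⟧
  LU₂ x y = L (U ⟦ x , y ⟧)

  Max Min : Subset Carrier → Subset Carrier
  Max A a = A a × (∀ b → A b → a ≤ b → b ≡ a)
  Min A a = A a × (∀ b → A b → b ≤ a → b ≡ a)

  Distributive : Set
  Distributive = ∀ x y z →
    L (U₂ x y ∪[ z ]) ≐ L (U (L₂ x z ∪ L₂ y z))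

record BooleanPoset : Set₁ where
  field
    poset : Poset₀
  open Poset₀ poset public
  open PosetOps poset public
  field
    𝟎 𝟏 : Carrier
    𝟎-least : ∀ x → 𝟎 ≤ x
    𝟏-greatest : ∀ x → x ≤ 𝟏
    _′ : Carrier → Carrier
    compl-U : ∀ x → U₂ x (x ′) ≐ (λ w → w ≡ 𝟏)
    compl-L : ∀ x → L₂ x (x ′) ≐ (λ w → w ≡ 𝟎)
    distributive : Distributive

module _ (B : BooleanPoset) where
  open BooleanPoset B

  CompatibleWith : (Carrier → Carrier → Set) → (Carrier → Carrier → Subset Carrier) → Set
  CompatibleWith R Q = ∀ a₁ b₁ a₂ b₂ → R a₁ b₁ → R a₂ b₂ →
    ∃ λ a → ∃ λ b → Q a₁ a₂ a × Q b₁ b₂ b × R a b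

  record IsCongruence (Θ : Carrier → Carrier → Set) : Set where
    field
      isEquivalence : IsEquivalence Θ
      compat-MaxL : CompatibleWith Θ (λ x y → Max (L₂ x y))
      compat-MinU : CompatibleWith Θ (λ x y → Min (U₂ x y))
      compat-′ : ∀ a b → Θ a b → Θ (a ′) (b ′)

  class1 : (Carrier → Carrier → Set) → Subset Carrier
  class1 Θ z = Θ z 𝟏

  LUCondition : (Carrier → Carrier → Set) → Set
  LUCondition Ψ = ∀ x y → Ψ x y → x ≤ y →
    ∃ λ z → LU₂ x (y ′) z × class1 Ψ z

{-# OPTIONS --safe #-}
module Submission where

open import Defs
open import Function.Bundles using (_⇔_; mk⇔; Equivalence)
open import Data.Product using (_×_; _,_; ∃)
open import Data.Sum using (inj₁; inj₂)
open import Relation.Binary.Core using (_⇒_)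
open import Relation.Binary.PropositionalEquality using (_≡_; refl; sym; subst; subst₂)
open import Relation.Binary.Structures using (IsPartialOrder; IsEquivalence)
open import Relation.Unary using (_⊆_)

-- If x Θ y, compatibility with Max L applied to (x,y) and (y,y) yields a ≤ x, y with
-- a Θ x and a Θ y, so it suffices to transfer comparable pairs a ≤ x from Θ to Φ.
-- For those the LU condition gives z ∈ LU(a,x′) with z Θ 1, hence z Φ 1; meeting
-- z Φ 1 with x Φ x gives c ≤ z, x with c Φ x, and distributivity together with
-- L(x′,x) = {0} forces c ≤ a. Finally Φ-classes are convex (compatibility with Min U),
-- so c ≤ a ≤ x and c Φ x give a Φ x.

module ConeProperties (𝑷 : Poset₀) where
  open Poset₀ 𝑷
  open PosetOps 𝑷
  open IsPartialOrder isPartialOrder using () renaming (refl to ≤-refl)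

  L₂-intro : ∀ {x y z} → z ≤ x → z ≤ y → L₂ x y z
  L₂-intro z≤x z≤y _ (inj₁ refl) = z≤x
  L₂-intro z≤x z≤y _ (inj₂ refl) = z≤y

  U₂-intro : ∀ {x y z} → x ≤ z → y ≤ z → U₂ x y z
  U₂-intro x≤z y≤z _ (inj₁ refl) = x≤z
  U₂-intro x≤z y≤z _ (inj₂ refl) = y≤z

  Max-of-greatest : ∀ {A m d} → A m → (∀ b → A b → b ≤ m) → Max A d → d ≡ m
  Max-of-greatest {m = m} Am greatest (Ad , maximal) = sym (maximal m Am (greatest _ Ad))

  Min-of-least : ∀ {A m d} → A m → (∀ b → A b → m ≤ b) → Min A d → d ≡ m
  Min-of-least {m = m} Am least (Ad , minimal) = sym (minimal m Am (least _ Ad))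

  Max-L₂≡ʳ : ∀ {x y d} → y ≤ x → Max (L₂ x y) d → d ≡ y
  Max-L₂≡ʳ y≤x = Max-of-greatest (L₂-intro y≤x ≤-refl) (λ b b∈L → b∈L _ (inj₂ refl))

  Min-U₂≡ˡ : ∀ {x y d} → y ≤ x → Min (U₂ x y) d → d ≡ x
  Min-U₂≡ˡ y≤x = Min-of-least (U₂-intro ≤-refl y≤x) (λ b b∈U → b∈U _ (inj₁ refl))

  Min-U₂≡ʳ : ∀ {x y d} → x ≤ y → Min (U₂ x y) d → d ≡ y
  Min-U₂≡ʳ x≤y = Min-of-least (U₂-intro x≤y ≤-refl) (λ b b∈U → b∈U _ (inj₂ refl))

module _ (B : BooleanPoset) where
  open BooleanPoset B
  open ConeProperties poset
  open IsPartialOrder isPartialOrder using () renaming (refl to ≤-refl; trans to ≤-trans)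

  L₂-compl-bottom : ∀ {x w} → L₂ (x ′) x w → w ≡ 𝟎
  L₂-compl-bottom {x} w∈L = Equivalence.to (compl-L x _)
    (L₂-intro (w∈L x (inj₂ refl)) (w∈L (x ′) (inj₁ refl)))

  LU₂-compl⇒≤ : ∀ {a x c} → LU₂ a (x ′) c → c ≤ x → c ≤ a
  LU₂-compl⇒≤ {a} {x} {c} c∈LU c≤x =
    Equivalence.to (distributive a (x ′) x c) c∈L a a-upper
    where
    c∈L : L (U₂ a (x ′) ∪[ x ]) c
    c∈L w (inj₁ w∈U) = c∈LU w w∈U
    c∈L _ (inj₂ refl) = c≤x

    a-upper : U (L₂ a x ∪ L₂ (x ′) x) a
    a-upper w (inj₁ w∈L) = w∈L a (inj₁ refl)
    a-upper w (inj₂ w∈L) = subst (_≤ a) (sym (L₂-compl-bottom w∈L)) (𝟎-least a)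

  module CongruenceProperties {Θ : Carrier → Carrier → Set} (isCongruence : IsCongruence B Θ) where
    open IsCongruence isCongruence
    open IsEquivalence isEquivalence public using () renaming (refl to Θ-refl; sym to Θ-sym; trans to Θ-trans)

    lower-bound-related : ∀ {x y w} → Θ x y → w ≤ y → ∃ λ a → L₂ x w a × Θ a w
    lower-bound-related {x} {y} {w} θxy w≤y
      with compat-MaxL x y w w θxy Θ-refl
    ... | a , b , (a∈L , _) , b∈Max , θab = a , a∈L , subst (Θ a) (Max-L₂≡ʳ w≤y b∈Max) θab

    convex : ∀ {c a x} → Θ c x → c ≤ a → a ≤ x → Θ a x
    convex {c} {a} {x} θcx c≤a a≤x
      with compat-MinU a a c x Θ-refl θcx
    ... | p , q , p∈Min , q∈Min , θpq = subst₂ Θ (Min-U₂≡ˡ c≤a p∈Min) (Min-U₂≡ʳ a≤x q∈Min) θpq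

  ≤-related-transfer : ∀ {Θ Φ} → IsCongruence B Φ → LUCondition B Θ →
    class1 B Θ ⊆ class1 B Φ → ∀ {a x} → a ≤ x → Θ a x → Φ a x
  ≤-related-transfer isCongΦ luΘ class1⊆ {a} {x} a≤x θax
    with luΘ a x θax a≤x
  ... | z , z∈LU , θz1
    with CongruenceProperties.lower-bound-related isCongΦ (class1⊆ θz1) (𝟏-greatest x)
  ... | c , c∈L , φcx = CongruenceProperties.convex isCongΦ φcx c≤a a≤x
    where
    c≤a : c ≤ a
    c≤a = LU₂-compl⇒≤ (λ w w∈U → ≤-trans (c∈L z (inj₁ refl)) (z∈LU w w∈U)) (c∈L x (inj₂ refl))

  congruence-⊆ : ∀ {Θ Φ} → IsCongruence B Θ → IsCongruence B Φ → LUCondition B Θ →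
    class1 B Θ ⊆ class1 B Φ → Θ ⇒ Φ
  congruence-⊆ {Θ} {Φ} isCongΘ isCongΦ luΘ class1⊆ {x} {y} θxy
    with CongruenceProperties.lower-bound-related isCongΘ θxy ≤-refl
  ... | a , a∈L , θay =
    Φ-trans (Φ-sym (transfer (a∈L x (inj₁ refl)) θax)) (transfer (a∈L y (inj₂ refl)) θay)
    where
    open CongruenceProperties isCongΘ using (Θ-sym; Θ-trans)
    open CongruenceProperties isCongΦ using () renaming (Θ-sym to Φ-sym; Θ-trans to Φ-trans)

    transfer : ∀ {a x} → a ≤ x → Θ a x → Φ a x
    transfer = ≤-related-transfer isCongΦ luΘ class1⊆

    θax : Θ a x
    θax = Θ-trans θay (Θ-sym θxy)

corollary5p8 : (B : BooleanPoset) → let open BooleanPoset B in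
    (Θ Φ : Carrier → Carrier → Set) →
    IsCongruence B Θ → IsCongruence B Φ →
    LUCondition B Θ → LUCondition B Φ →
    (∀ z → class1 B Θ z ⇔ class1 B Φ z) →
    ∀ x y → Θ x y ⇔ Φ x y
corollary5p8 B Θ Φ isCongΘ isCongΦ luΘ luΦ class1≐ x y = mk⇔
  (congruence-⊆ B isCongΘ isCongΦ luΘ (Equivalence.to (class1≐ _)))
  (congruence-⊆ B isCongΦ isCongΘ luΦ (Equivalence.from (class1≐ _)))
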